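{- Let $T\subseteq\{0,1\}^\star$ be a regular, $T_{\mathrm{bin}}$-free binary tree. Then there exists a constant $C\in\mathbb N$ such that every anti-chain $A\subseteq T$ (with respect to the prefix order) contains at most $C$ elements $u$ with $\operatorname{CB}_*(T\restriction u)=\operatorname{CB}_*(T)$.
   Context: A binary tree is a prefix-closed subset $T\subseteq\{0,1\}^\star$, ordered by the prefix relation $\preceq$; it is regular if it is a regular language. For $u\in T$, $T\restriction u=\{v\in\{0,1\}^\star: uv\in T\}$. $T_{\mathrm{bin}}=\{0,1\}^\star$; $T$ is $T_{\mathrm{bin}}$-free if there is no injection $f\colon T_{\mathrm{bin}}\to T$ with $u\preceq v\iff f(u)\preceq f(v)$. An infinite branch of $T$ is an infinite prefix-closed subset linearly ordered by $\preceq$. The derivative $d(T)$ is the set of $u\in T$ lying on at least two distinct infinite branches of $T$; $d^{(0)}(T)=T$, $d^{(n)}(T)=d(d^{(n-1)}(T))$. For a regular $T_{\mathrm{bin}}$-free binary tree, some $d^{(n)}(T)$ is finite, and $\operatorname{CB}_*(T)$ is the least such $n$. An anti-chain is a set of pairwise $\preceq$-incomparable elements. -}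

module Defs where

open import Level using (Level; 0ℓ; _⊔_; Lift) renaming (suc to lsuc)
open import Data.Bool using (Bool; true; false)
open import Data.List using (List; []; _∷_; _++_; length)
open import Data.List.Membership.Propositional using (_∈_)
open import Data.Nat using (ℕ; zero; suc; _<_)
open import Data.Fin using (Fin)
open import Data.Sum using (_⊎_)
open import Data.Product using (Σ; ∃; _×_; _,_)
open import Relation.Binary.PropositionalEquality using (_≡_)
open import Relation.Nullary using (¬_)
open import Function.Bundles using (_⇔_)
open import Function.Definitions using (Injective)

-- Words over {0,1}: lists of booleans (false = 0, true = 1).
Word : Set
Word = List Bool

Pred : (ℓ : Level) → Set (lsuc ℓ)
Pred ℓ = Word → Set ℓ

_≼_ : Word → Word → Set
u ≼ v = ∃ λ w → u ++ w ≡ v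

-- Prefix-closed subset (= binary tree).
IsTree : ∀ {ℓ} → Pred ℓ → Set ℓ
IsTree T = ∀ u v → u ≼ v → T v → T u

run : ∀ {n} → (Fin n → Bool → Fin n) → Fin n → Word → Fin n
run δ q []       = q
run δ q (b ∷ w)  = run δ (δ q b) w

Regular : Pred 0ℓ → Set
Regular T = Σ ℕ λ n → Σ (Fin n → Bool → Fin n) λ δ → Σ (Fin n) λ q₀ →
  Σ (Fin n → Bool) λ F → ∀ w → T w ⇔ (F (run δ q₀ w) ≡ true)

TbinFree : Pred 0ℓ → Set
TbinFree T = ¬ (Σ (Word → Word) λ f → Injective _≡_ _≡_ f ×
  (∀ u → T (f u)) × (∀ u v → (u ≼ v) ⇔ (f u ≼ f v)))

_↾_ : Pred 0ℓ → Word → Pred 0ℓ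
(T ↾ u) v = T (u ++ v)

Finite : ∀ {ℓ} → Pred ℓ → Set ℓ
Finite P = ∃ λ (L : List Word) → ∀ x → P x → x ∈ L

Infinite : ∀ {ℓ} → Pred ℓ → Set ℓ
Infinite P = ¬ Finite P

IsBranch : ∀ {ℓ} → Pred ℓ → Pred 0ℓ → Set ℓ
IsBranch T B = (∀ x → B x → T x) × IsTree B × Infinite B ×
  (∀ x y → B x → B y → (x ≼ y) ⊎ (y ≼ x))

SameSet : Pred 0ℓ → Pred 0ℓ → Set
SameSet A B = ∀ x → A x ⇔ B x

-- Working level for (iterated) derivatives: Set₁, because d quantifies
-- over branches B : Word → Set.
Pred₁ : Set₂
Pred₁ = Pred (lsuc 0ℓ)

d : Pred₁ → Pred₁
d T u = T u × Σ (Pred 0ℓ) λ B₁ → Σ (Pred 0ℓ) λ B₂ →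
  IsBranch T B₁ × IsBranch T B₂ × ¬ SameSet B₁ B₂ × B₁ u × B₂ u

dIter : ℕ → Pred 0ℓ → Pred₁
dIter zero    T u = Lift (lsuc 0ℓ) (T u)
dIter (suc n) T   = d (dIter n T)

IsCB : Pred 0ℓ → ℕ → Set₁
IsCB T n = Finite (dIter n T) × (∀ m → m < n → Infinite (dIter m T))

AntiChain : Pred 0ℓ → Set
AntiChain A = ∀ u v → A u → A v → u ≼ v → u ≡ v

_⊆_ : Pred 0ℓ → Pred 0ℓ → Set
A ⊆ B = ∀ x → A x → B x

module Submission where

-- Let T be a regular tree recognised by an automaton with k states, and let
-- CB_*(T) = n.  Then C = #(words of length ≤ k) bounds every antichain of words
-- u ∈ T with CB_*(T↾u) = n, because truncation to length k is injective on it.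
-- For n = 0, T is finite, and by pumping all its words are shorter than k.
-- For n = m + 1, distinct u, v agreeing on k letters split apart at some r with
-- |r| ≥ k; both are fertile (have infinitely many extensions) in d^(m)(T), so
-- the two children of r are fertile, and the leftmost branches through them
-- put r into the finite set d^(m+1)(T), again contradicting pumping.
--
-- Classical steps appear as double negations, discharged by decidability.

open import Defs
open import Level using (0ℓ; lift)
open import Function using (_∘_)
open import Data.Bool using (Bool; true; false)
import Data.Bool as Bool
open import Data.Nat using (ℕ; zero; suc; _≤_; _<_; z≤n; s≤s; _⊔_; _∸_; _≤?_)
open import Data.Nat.Properties
  using (≤-refl; ≤-trans; ≤-reflexive; <⇒≤; <⇒≱; ≰⇒>; ≤-pred; 1+n≰n; n<1+n;
         m≤m⊔n; m≤n⊔m; +-mono-≤; m≤n⇒m⊓n≡m; m<n⇒0<n∸m)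
open import Data.List using (List; []; _∷_; _++_; length; map; take; drop; [_])
open import Data.List.Properties
  using (++-identityʳ; ++-assoc; ++-cancelˡ; ∷-injective; ∷ʳ-injectiveˡ; ∷ʳ-injectiveʳ;
         length-++; length-++-sucʳ; length-++-≤ˡ; length-++-≤ʳ; length-take; length-drop;
         take-all; take-take; take++drop≡id; ≡-dec)
open import Data.List.Membership.Propositional using (_∈_)
open import Data.List.Membership.Propositional.Properties
  using (∈-∃++; ∈-++⁻; ∈-++⁺ˡ; ∈-++⁺ʳ; ∈-map⁺)
open import Data.List.Relation.Unary.Any using (here; there)
open import Data.List.Relation.Unary.All as All using (All)
open import Data.List.Relation.Unary.AllPairs using (_∷_)
open import Data.List.Relation.Unary.Unique.Propositional using (Unique)
open import Data.Fin using (Fin; toℕ) renaming (zero to fzero; suc to fsuc)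
open import Data.Fin.Properties using (pigeonhole; toℕ<n)
open import Data.Product using (Σ; _×_; _,_; proj₁; proj₂)
open import Data.Sum as Sum using (_⊎_; inj₁; inj₂)
open import Data.Empty using (⊥; ⊥-elim)
open import Relation.Nullary using (¬_; Dec; yes; no)
open import Relation.Nullary.Decidable using (decidable-stable; ¬¬-excluded-middle)
open import Relation.Binary.PropositionalEquality using (_≡_; _≢_; refl; sym; trans; cong; subst; module ≡-Reasoning)
open import Function.Bundles using (_⇔_; mk⇔; Equivalence)
import Function.Properties.Equivalence as ⇔

≼-refl : ∀ u → u ≼ u
≼-refl u = [] , ++-identityʳ u

≼-++ : ∀ u v → u ≼ (u ++ v)
≼-++ u v = v , refl

[]-≼ : ∀ u → [] ≼ u
[]-≼ u = u , refl

≼-trans : ∀ {u v w} → u ≼ v → v ≼ w → u ≼ w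
≼-trans {u} (a , refl) (b , refl) = a ++ b , sym (++-assoc u a b)

≼-ext : ∀ x {u v} → u ≼ v → (x ++ u) ≼ (x ++ v)
≼-ext x {u} (w , refl) = w , ++-assoc x u w

≼-cancel : ∀ x {u v} → (x ++ u) ≼ (x ++ v) → u ≼ v
≼-cancel x {u} (w , e) = w , ++-cancelˡ x (u ++ w) _ (trans (sym (++-assoc x u w)) e)

≼-length : ∀ {u v} → u ≼ v → length u ≤ length v
≼-length {u} (w , refl) = length-++-≤ˡ u

length-snoc : ∀ (x : Word) b → length (x ++ [ b ]) ≡ suc (length x)
length-snoc []      b = refl
length-snoc (_ ∷ x) b = cong suc (length-snoc x b)

≼-comparable : ∀ {u v w} → u ≼ w → v ≼ w → u ≼ v ⊎ v ≼ u
≼-comparable {[]}    _ _ = inj₁ ([]-≼ _)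
≼-comparable {_ ∷ _} {[]} _ _ = inj₂ ([]-≼ _)
≼-comparable {b ∷ u} {c ∷ v} (a , refl) (a′ , e) with ∷-injective e
... | refl , e′ = Sum.map (≼-ext [ b ]) (≼-ext [ b ]) (≼-comparable (a , refl) (a′ , e′))

extension-≼-empty : ∀ x {v} → (x ++ v) ≼ x → v ≡ []
extension-≼-empty []      {[]}    _       = refl
extension-≼-empty []      {_ ∷ _} (_ , ())
extension-≼-empty (b ∷ x) h = extension-≼-empty x (≼-cancel [ b ] h)

≼-singleton : ∀ {e} b → e ≼ [ b ] → e ≡ [] ⊎ e ≡ [ b ]
≼-singleton {[]}          b _        = inj₁ refl
≼-singleton {_ ∷ []}      b ([] , refl) = inj₂ refl
≼-singleton {_ ∷ []}      b (_ ∷ _ , ())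
≼-singleton {_ ∷ _ ∷ _}   b (_ , ())

≼-snoc : ∀ {a} x b → a ≼ (x ++ [ b ]) → a ≼ x ⊎ a ≡ x ++ [ b ]
≼-snoc x b h with ≼-comparable h (≼-++ x [ b ])
... | inj₁ a≼x = inj₁ a≼x
... | inj₂ (e , refl) with ≼-singleton b (≼-cancel x h)
...   | inj₁ refl = inj₁ ([] , trans (++-identityʳ _) (++-identityʳ x))
...   | inj₂ refl = inj₂ refl

children-apart : ∀ r {w} → (r ++ [ false ]) ≼ w → (r ++ [ true ]) ≼ w → ⊥
children-apart r p q with ≼-comparable p q
... | inj₁ h with ≼-cancel r h
...   | _ , ()
children-apart r p q | inj₂ h with ≼-cancel r h
...   | _ , ()

Splits : Word → Word → Word → Set
Splits r u v = (r ++ [ false ]) ≼ u × (r ++ [ true ]) ≼ v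

Position : Word → Word → Set
Position u v = u ≼ v ⊎ v ≼ u ⊎ Σ Word λ r → Splits r u v ⊎ Splits r v u

cons-position : ∀ b {u v} → Position u v → Position (b ∷ u) (b ∷ v)
cons-position b = Sum.map (≼-ext [ b ]) (Sum.map (≼-ext [ b ]) cons-split)
  where
  cons-splits : ∀ {r u v} → Splits r u v → Splits (b ∷ r) (b ∷ u) (b ∷ v)
  cons-splits (p , q) = ≼-ext [ b ] p , ≼-ext [ b ] q
  cons-split : ∀ {u v} → (Σ Word λ r → Splits r u v ⊎ Splits r v u) →
    Σ Word λ r → Splits r (b ∷ u) (b ∷ v) ⊎ Splits r (b ∷ v) (b ∷ u)
  cons-split (r , s) = b ∷ r , Sum.map cons-splits cons-splits s

compare : ∀ u v → Position u v
compare []          v           = inj₁ ([]-≼ v)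
compare (_ ∷ _)     []          = inj₂ (inj₁ ([]-≼ _))
compare (false ∷ u) (true ∷ v)  = inj₂ (inj₂ ([] , inj₁ ((u , refl) , (v , refl))))
compare (true ∷ u)  (false ∷ v) = inj₂ (inj₂ ([] , inj₂ ((v , refl) , (u , refl))))
compare (false ∷ u) (false ∷ v) = cons-position false (compare u v)
compare (true ∷ u)  (true ∷ v)  = cons-position true (compare u v)

antichain-splits : ∀ {A} → AntiChain A → ∀ {u v} → A u → A v → u ≢ v →
  Σ Word λ r → Splits r u v ⊎ Splits r v u
antichain-splits anti {u} {v} au av u≢v with compare u v
... | inj₁ u≼v         = ⊥-elim (u≢v (anti u v au av u≼v))
... | inj₂ (inj₁ v≼u)  = ⊥-elim (u≢v (sym (anti v u av au v≼u)))
... | inj₂ (inj₂ split) = split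

splits-below : ∀ {p r u v} → p ≼ u → p ≼ v → Splits r u v → p ≼ r
splits-below {r = r} p≼u p≼v (r0≼u , r1≼v) with ≼-comparable p≼u r0≼u
... | inj₂ r0≼p = ⊥-elim (children-apart r (≼-trans r0≼p p≼v) r1≼v)
... | inj₁ p≼r0 with ≼-snoc r false p≼r0
...   | inj₁ p≼r = p≼r
...   | inj₂ refl = ⊥-elim (children-apart r p≼v r1≼v)

≼-take : ∀ {x u} k → x ≼ u → length x ≤ k → x ≼ take k u
≼-take {[]}    k       _        _        = []-≼ _
≼-take {b ∷ x} (suc k) (a , refl) (s≤s le) = ≼-ext [ b ] (≼-take k (a , refl) le)

splits-late : ∀ k {r u v} → Splits r u v → take k u ≡ take k v → k ≤ length r
splits-late k {r} (r0≼u , r1≼v) e with k ≤? length r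
... | yes k≤r = k≤r
... | no k≰r = ⊥-elim (children-apart r
        (subst ((r ++ [ false ]) ≼_) e (≼-take k r0≼u (child-short false)))
        (≼-take k r1≼v (child-short true)))
  where
  child-short : ∀ b → length (r ++ [ b ]) ≤ k
  child-short b = ≤-trans (≤-reflexive (length-snoc r b)) (≰⇒> k≰r)

∈-remove : ∀ {A : Set} {x y : A} xs {zs} → y ∈ xs ++ x ∷ zs → y ≢ x → y ∈ xs ++ zs
∈-remove xs y∈ y≢x with ∈-++⁻ xs y∈
... | inj₁ y∈xs         = ∈-++⁺ˡ y∈xs
... | inj₂ (here y≡x)   = ⊥-elim (y≢x y≡x)
... | inj₂ (there y∈zs) = ∈-++⁺ʳ xs y∈zs

length-≤-injection : ∀ {A B : Set} (f : A → B) {xs : List A} {ys : List B} → Unique xs →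
  (∀ {x y} → x ∈ xs → y ∈ xs → f x ≡ f y → x ≡ y) → (∀ {x} → x ∈ xs → f x ∈ ys) →
  length xs ≤ length ys
length-≤-injection f {[]}     _                _   _    = z≤n
length-≤-injection f {x ∷ xs} (x∉xs ∷ unique) inj into with ∈-∃++ (into (here refl))
... | ys₁ , ys₂ , refl =
  subst (suc (length xs) ≤_) (sym (length-++-sucʳ ys₁ (f x) ys₂))
    (s≤s (length-≤-injection f unique (λ p q → inj (there p) (there q)) into′))
  where
  into′ : ∀ {y} → y ∈ xs → f y ∈ ys₁ ++ ys₂
  into′ y∈xs = ∈-remove ys₁ (into (there y∈xs))
    (λ fy≡fx → All.lookup x∉xs y∈xs (sym (inj (there y∈xs) (here refl) fy≡fx)))

words≤ : ℕ → List Word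
words≤ zero    = [ [] ]
words≤ (suc k) = [] ∷ (map (false ∷_) (words≤ k) ++ map (true ∷_) (words≤ k))

take-∈-words≤ : ∀ k w → take k w ∈ words≤ k
take-∈-words≤ zero    w           = here refl
take-∈-words≤ (suc k) []          = here refl
take-∈-words≤ (suc k) (false ∷ w) = there (∈-++⁺ˡ (∈-map⁺ (false ∷_) (take-∈-words≤ k w)))
take-∈-words≤ (suc k) (true ∷ w)  =
  there (∈-++⁺ʳ (map (false ∷_) (words≤ k)) (∈-map⁺ (true ∷_) (take-∈-words≤ k w)))

∈-words≤ : ∀ {k} w → length w ≤ k → w ∈ words≤ k
∈-words≤ {k} w le = subst (_∈ words≤ k) (take-all k w le) (take-∈-words≤ k w)

finite-⊆ : ∀ {ℓ ℓ′} {P : Pred ℓ} {Q : Pred ℓ′} → Finite Q → (∀ x → P x → Q x) → Finite P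
finite-⊆ (L , covers) P⊆Q = L , λ x px → covers x (P⊆Q x px)

finite-cons : ∀ {ℓ} {P : Pred ℓ} →
  Finite (λ v → P (false ∷ v)) → Finite (λ v → P (true ∷ v)) → Finite P
finite-cons {P = P} (L₀ , c₀) (L₁ , c₁) = [] ∷ (map (false ∷_) L₀ ++ map (true ∷_) L₁) , covers
  where
  covers : ∀ v → P v → v ∈ [] ∷ (map (false ∷_) L₀ ++ map (true ∷_) L₁)
  covers []          _  = here refl
  covers (false ∷ v) pv = there (∈-++⁺ˡ (∈-map⁺ (false ∷_) (c₀ v pv)))
  covers (true ∷ v)  pv = there (∈-++⁺ʳ (map (false ∷_) L₀) (∈-map⁺ (true ∷_) (c₁ v pv)))

maxLength : List Word → ℕ
maxLength []      = 0
maxLength (x ∷ L) = length x ⊔ maxLength L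

maxLength-≥ : ∀ {x} L → x ∈ L → length x ≤ maxLength L
maxLength-≥ (y ∷ L) (here refl) = m≤m⊔n _ _
maxLength-≥ (y ∷ L) (there x∈L) = ≤-trans (maxLength-≥ L x∈L) (m≤n⊔m _ _)

unbounded⇒infinite : ∀ {ℓ} (P : Pred ℓ) → (∀ t → Σ Word λ x → P x × t ≤ length x) → Infinite P
unbounded⇒infinite P long (L , covers) with long (suc (maxLength L))
... | x , px , longer = <⇒≱ longer (maxLength-≥ L (covers x px))

infinite-shift : ∀ {ℓ ℓ′} {P : Pred ℓ} {Q : Pred ℓ′} e →
  (∀ x → P x → Q (e ++ x)) → Infinite P → Infinite Q
infinite-shift {P = P} e shift infP (L , covers) = infP (map (drop (length e)) L , covers′)
  where
  drop-prefix : ∀ (e x : Word) → drop (length e) (e ++ x) ≡ x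
  drop-prefix []      x = refl
  drop-prefix (_ ∷ e) x = drop-prefix e x
  covers′ : ∀ x → P x → x ∈ map (drop (length e)) L
  covers′ x px = subst (_∈ map (drop (length e)) L) (drop-prefix e x)
    (∈-map⁺ (drop (length e)) (covers (e ++ x) (shift x px)))

infinite-above : ∀ {ℓ} {P : Pred ℓ} x → (∀ q → P q → q ≼ x ⊎ x ≼ q) →
  Infinite P → Infinite (λ v → P (x ++ v))
infinite-above {P = P} x comparable infP (L , covers) =
  infP (words≤ (length x) ++ map (x ++_) L , covers′)
  where
  covers′ : ∀ q → P q → q ∈ words≤ (length x) ++ map (x ++_) L
  covers′ q pq with comparable q pq
  ... | inj₁ q≼x       = ∈-++⁺ˡ (∈-words≤ q (≼-length q≼x))
  ... | inj₂ (v , refl) = ∈-++⁺ʳ (words≤ (length x)) (∈-map⁺ (x ++_) (covers v pq))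

d-tree : (S : Pred₁) → IsTree (d S)
d-tree S u v u≼v (_ , B₁ , B₂ , br₁ , br₂ , B₁≠B₂ , b₁ , b₂) =
  proj₁ br₁ u (proj₁ (proj₂ br₁) u v u≼v b₁) , B₁ , B₂ , br₁ , br₂ , B₁≠B₂ ,
  proj₁ (proj₂ br₁) u v u≼v b₁ , proj₁ (proj₂ br₂) u v u≼v b₂

dIter-tree : ∀ (T : Pred 0ℓ) → IsTree T → ∀ m → IsTree (dIter m T)
dIter-tree T tree zero    u v u≼v (lift t) = lift (tree u v u≼v t)
dIter-tree T tree (suc m) = d-tree (dIter m T)

module Shift (S₁ S₂ : Pred₁) (x₁ x₂ : Word) (tree₂ : IsTree S₂)
             (embed : ∀ w → S₁ (x₁ ++ w) → S₂ (x₂ ++ w)) where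

  shift : Pred 0ℓ → Pred 0ℓ
  shift B p = p ≼ x₂ ⊎ Σ Word λ v → p ≡ x₂ ++ v × B (x₁ ++ v)

  through-x₁ : ∀ {B w} → IsBranch S₁ B → B (x₁ ++ w) → B x₁
  through-x₁ {w = w} (_ , tree , _) b = tree _ _ (≼-++ _ w) b

  shift-branch : ∀ {B w} → IsBranch S₁ B → B (x₁ ++ w) → IsBranch S₂ (shift B)
  shift-branch {B} {w} br@(sub , tree , inf , linear) b = sub′ , tree′ , inf′ , linear′
    where
    sub′ : ∀ p → shift B p → S₂ p
    sub′ p (inj₁ p≼x₂)            = tree₂ p (x₂ ++ w) (≼-trans p≼x₂ (≼-++ x₂ w)) (embed w (sub _ b))
    sub′ _ (inj₂ (v , refl , bv)) = embed v (sub _ bv)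

    tree′ : IsTree (shift B)
    tree′ p q p≼q (inj₁ q≼x₂) = inj₁ (≼-trans p≼q q≼x₂)
    tree′ p _ p≼q (inj₂ (v , refl , bv)) with ≼-comparable p≼q (≼-++ x₂ v)
    ... | inj₁ p≼x₂       = inj₁ p≼x₂
    ... | inj₂ (e , refl) = inj₂ (e , refl , tree _ _ (≼-ext x₁ (≼-cancel x₂ p≼q)) bv)

    linear′ : ∀ p q → shift B p → shift B q → p ≼ q ⊎ q ≼ p
    linear′ _ _ (inj₁ a) (inj₁ c)                = ≼-comparable a c
    linear′ _ _ (inj₁ a) (inj₂ (v , refl , _))   = inj₁ (≼-trans a (≼-++ x₂ v))
    linear′ _ _ (inj₂ (v , refl , _)) (inj₁ a)   = inj₂ (≼-trans a (≼-++ x₂ v))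
    linear′ _ _ (inj₂ (v , refl , bv)) (inj₂ (v′ , refl , bv′)) =
      Sum.map (≼-ext x₂ ∘ ≼-cancel x₁) (≼-ext x₂ ∘ ≼-cancel x₁) (linear _ _ bv bv′)

    inf′ : Infinite (shift B)
    inf′ = infinite-shift x₂ (λ v bv → inj₂ (v , refl , bv))
             (infinite-above x₁ (λ q bq → linear q x₁ bq (through-x₁ br b)) inf)

  shift-above : ∀ {B} v → B x₁ → shift B (x₂ ++ v) → B (x₁ ++ v)
  shift-above {B} v bx₁ (inj₁ x₂v≼x₂) with extension-≼-empty x₂ x₂v≼x₂
  ... | refl = subst B (sym (++-identityʳ x₁)) bx₁
  shift-above v _ (inj₂ (v′ , e , bv′)) with ++-cancelˡ x₂ v v′ e
  ... | refl = bv′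

  shift-reflects : ∀ {B₁ B₂} → IsBranch S₁ B₁ → IsBranch S₁ B₂ → B₁ x₁ → B₂ x₁ →
    SameSet (shift B₁) (shift B₂) → ∀ q → B₁ q → B₂ q
  shift-reflects {B₂ = B₂} (_ , _ , _ , linear₁) (_ , tree₂′ , _ , _) b₁ b₂ same q bq with linear₁ q x₁ bq b₁
  ... | inj₁ q≼x₁       = tree₂′ q x₁ q≼x₁ b₂
  ... | inj₂ (v , refl) = shift-above {B₂} v b₂ (Equivalence.to (same (x₂ ++ v)) (inj₂ (v , refl , bq)))

  -- Two distinct branches through x₁ w shift to two distinct branches through x₂ w.
  d-shift : ∀ w → d S₁ (x₁ ++ w) → d S₂ (x₂ ++ w)
  d-shift w (s , B₁ , B₂ , br₁ , br₂ , B₁≠B₂ , b₁ , b₂) =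
    embed w s , shift B₁ , shift B₂ , shift-branch br₁ b₁ , shift-branch br₂ b₂ ,
    (λ same → B₁≠B₂ λ q → mk⇔ (shift-reflects br₁ br₂ x₁∈B₁ x₁∈B₂ same q)
                              (shift-reflects br₂ br₁ x₁∈B₂ x₁∈B₁ (λ p → ⇔.sym (same p)) q)) ,
    inj₂ (w , refl , b₁) , inj₂ (w , refl , b₂)
    where
    x₁∈B₁ : B₁ x₁
    x₁∈B₁ = through-x₁ br₁ b₁
    x₁∈B₂ : B₂ x₁
    x₁∈B₂ = through-x₁ br₂ b₂

dIter-shift : ∀ {T₁ T₂ : Pred 0ℓ} x₁ x₂ → IsTree T₂ → (∀ w → T₁ (x₁ ++ w) → T₂ (x₂ ++ w)) →
  ∀ m w → dIter m T₁ (x₁ ++ w) → dIter m T₂ (x₂ ++ w)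
dIter-shift x₁ x₂ tree embed zero w (lift t) = lift (embed w t)
dIter-shift {T₁} {T₂} x₁ x₂ tree embed (suc m) =
  Shift.d-shift (dIter m T₁) (dIter m T₂) x₁ x₂ (dIter-tree T₂ tree m) (dIter-shift x₁ x₂ tree embed m)

run-++ : ∀ {n} (δ : Fin n → Bool → Fin n) q x y → run δ q (x ++ y) ≡ run δ (run δ q x) y
run-++ δ q []      y = refl
run-++ δ q (b ∷ x) y = run-++ δ (δ q b) x y

¬¬-∀-Fin : ∀ {ℓ n} (P : Fin n → Set ℓ) → (∀ i → ¬ ¬ P i) → ¬ ¬ (∀ i → P i)
¬¬-∀-Fin {n = zero}  P _ ¬all = ¬all λ ()
¬¬-∀-Fin {n = suc n} P h ¬all =
  h fzero λ p₀ → ¬¬-∀-Fin (P ∘ fsuc) (h ∘ fsuc) λ ps → ¬all λ { fzero → p₀ ; (fsuc i) → ps i }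

flag : ∀ {ℓ} {A : Set ℓ} → Dec A → Σ Bool λ b → (b ≡ true) ⇔ A
flag (yes a) = true , mk⇔ (λ _ → a) (λ _ → refl)
flag (no ¬a) = false , mk⇔ (λ ()) (λ a → ⊥-elim (¬a a))

module Automaton {k : ℕ} (δ : Fin k → Bool → Fin k) (q₀ : Fin k) where

  state : Word → Fin k
  state = run δ q₀

  Compatible : ∀ {ℓ} → Pred ℓ → Set ℓ
  Compatible D = ∀ x x′ → state x ≡ state x′ → ∀ v → D (x ++ v) → D (x′ ++ v)

  accepted-compatible : (F : Fin k → Bool) (T : Pred 0ℓ) →
    (∀ w → T w ⇔ (F (state w) ≡ true)) → Compatible T
  accepted-compatible F T accepts x x′ e v t = Equivalence.from (accepts (x′ ++ v)) (begin
      F (state (x′ ++ v))     ≡⟨ cong F (run-++ δ q₀ x′ v) ⟩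
      F (run δ (state x′) v)  ≡⟨ cong (λ q → F (run δ q v)) (sym e) ⟩
      F (run δ (state x) v)   ≡⟨ cong F (sym (run-++ δ q₀ x v)) ⟩
      F (state (x ++ v))      ≡⟨ Equivalence.to (accepts (x ++ v)) t ⟩
      true                    ∎)
    where open ≡-Reasoning

  dIter-compatible : ∀ {T} → IsTree T → Compatible T → ∀ m → Compatible (dIter m T)
  dIter-compatible tree compatible m x x′ e = dIter-shift x x′ tree (compatible x x′ e) m

  loop : ∀ w → k ≤ length w → Σ Word λ x → Σ Word λ y → Σ Word λ v →
    w ≡ x ++ v × 1 ≤ length y × state x ≡ state (x ++ y)
  loop w k≤w with pigeonhole ≤-refl (λ (i : Fin (suc k)) → state (take (toℕ i) w))
  ... | i , j , i<j , same = take a w , drop a (take b w) , drop a w ,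
          sym (take++drop≡id a w) , nonempty , trans same (cong state (sym prefix))
    where
    a = toℕ i
    b = toℕ j
    b≤w : b ≤ length w
    b≤w = ≤-trans (≤-pred (toℕ<n j)) k≤w
    prefix : take a w ++ drop a (take b w) ≡ take b w
    prefix = trans (cong (_++ drop a (take b w))
                     (sym (trans (take-take a b w) (cong (λ m → take m w) (m≤n⇒m⊓n≡m (<⇒≤ i<j))))))
                   (take++drop≡id a (take b w))
    nonempty : 1 ≤ length (drop a (take b w))
    nonempty = subst (1 ≤_)
      (sym (trans (length-drop a (take b w))
                  (cong (_∸ a) (trans (length-take b w) (m≤n⇒m⊓n≡m b≤w)))))
      (m<n⇒0<n∸m i<j)

  pumping : ∀ {ℓ} {D : Pred ℓ} → Compatible D → Finite D → ∀ {w} → D w → length w < k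
  pumping {D = D} compatible finite {w} dw with k ≤? length w
  ... | no k≰w = ≰⇒> k≰w
  ... | yes k≤w with loop w k≤w
  ...   | x , y , v , refl , nonempty , same = ⊥-elim (unbounded⇒infinite D pumped finite)
    where
    iterate : ∀ t → Σ Word λ z → D (x ++ z) × t ≤ length z
    iterate zero    = v , dw , z≤n
    iterate (suc t) with iterate t
    ... | z , dz , t≤z = y ++ z , subst D (++-assoc x y z) (compatible x (x ++ y) same z dz) ,
                         subst (suc t ≤_) (sym (length-++ y)) (+-mono-≤ nonempty t≤z)
    pumped : ∀ t → Σ Word λ u → D u × t ≤ length u
    pumped t with iterate t
    ... | z , dz , t≤z = x ++ z , dz , ≤-trans t≤z (length-++-≤ʳ z {x})

  ¬¬-state-classifier : ∀ {ℓ} (P : Word → Set ℓ) →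
    (∀ x x′ → state x ≡ state x′ → P x → P x′) →
    ¬ ¬ (Σ (Fin k → Bool) λ γ → ∀ x → (γ (state x) ≡ true) ⇔ P x)
  ¬¬-state-classifier {ℓ} P invariant ¬classifier =
    ¬¬-∀-Fin (λ q → Dec (Reached q)) (λ q → ¬¬-excluded-middle) (¬classifier ∘ classifier)
    where
    Reached : Fin k → Set ℓ
    Reached q = Σ Word λ x → state x ≡ q × P x
    classifier : (∀ q → Dec (Reached q)) → Σ (Fin k → Bool) λ γ → ∀ x → (γ (state x) ≡ true) ⇔ P x
    classifier decide = (λ q → proj₁ (flag (decide q))) , λ x → mk⇔
      (λ γx → let (x′ , e , px′) = Equivalence.to (proj₂ (flag (decide (state x)))) γx
              in invariant x′ x e px′)
      (λ px → Equivalence.from (proj₂ (flag (decide (state x)))) (x , refl , px))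

module Fertility (S : Pred₁) (tree : IsTree S) where

  Fertile : Word → Set₁
  Fertile x = S x × Infinite (λ v → S (x ++ v))

  infinite-above⇒¬¬member : ∀ x → Infinite (λ v → S (x ++ v)) → ¬ ¬ S x
  infinite-above⇒¬¬member x inf ¬sx = inf ([] , λ v sxv → ⊥-elim (¬sx (tree x (x ++ v) (≼-++ x v) sxv)))

  fertile-prefix : ∀ {p x} → p ≼ x → Fertile x → Fertile p
  fertile-prefix {p} (e , refl) (s , inf) =
    tree p (p ++ e) (≼-++ p e) s , infinite-shift e (λ v s′ → subst S (++-assoc p e v) s′) inf

  fertile-transfer : ∀ {x x′} → (∀ v → S (x ++ v) → S (x′ ++ v)) → Fertile x → Fertile x′
  fertile-transfer {x} {x′} embed (s , inf) =
    subst S (++-identityʳ x′) (embed [] (subst S (sym (++-identityʳ x)) s)) ,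
    λ finite → inf (finite-⊆ finite embed)

  fertile-child : ∀ x → Fertile x → ¬ Fertile (x ++ [ false ]) → ¬ Fertile (x ++ [ true ]) → ⊥
  fertile-child x (_ , inf) ¬f₀ ¬f₁ =
    finite-above false ¬f₀ λ fin₀ → finite-above true ¬f₁ λ fin₁ →
    inf (finite-cons (finite-⊆ fin₀ (reassoc false)) (finite-⊆ fin₁ (reassoc true)))
    where
    finite-above : ∀ b → ¬ Fertile (x ++ [ b ]) → ¬ Infinite (λ v → S ((x ++ [ b ]) ++ v))
    finite-above b ¬f inf′ = infinite-above⇒¬¬member (x ++ [ b ]) inf′ (λ s → ¬f (s , inf′))
    reassoc : ∀ b v → S (x ++ b ∷ v) → S ((x ++ [ b ]) ++ v)
    reassoc b v = subst S (sym (++-assoc x [ b ] v))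

  -- Given a Boolean test for fertility, the leftmost path of fertile words
  -- through a fertile word p is a branch of S.
  module Classified (good : Word → Bool) (classifies : ∀ x → (good x ≡ true) ⇔ Fertile x) where

    good⇒fertile : ∀ {x} → good x ≡ true → Fertile x
    good⇒fertile = Equivalence.to (classifies _)

    fertile⇒good : ∀ {x} → Fertile x → good x ≡ true
    fertile⇒good = Equivalence.from (classifies _)

    good-prefix : ∀ {p x} → p ≼ x → good x ≡ true → good p ≡ true
    good-prefix p≼x = fertile⇒good ∘ fertile-prefix p≼x ∘ good⇒fertile

    not-both : ∀ {x} → good x ≡ true → good x ≡ false → ⊥
    not-both t f with trans (sym t) f
    ... | ()

    -- Since leaving p, x never went right of a good left sibling.
    Leftmost : Word → Word → Set
    Leftmost p x = ∀ r → p ≼ r → (r ++ [ true ]) ≼ x → good (r ++ [ false ]) ≡ false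

    OnPath : Word → Word → Set
    OnPath p x = p ≼ x × good x ≡ true × Leftmost p x

    leftmost : Word → Pred 0ℓ
    leftmost p x = x ≼ p ⊎ OnPath p x

    start : ∀ {p} → good p ≡ true → OnPath p p
    start {p} gp = ≼-refl p , gp , λ r p≼r r1≼p → ⊥-elim (
      1+n≰n (≤-trans (≤-reflexive (sym (length-snoc r true)))
                     (≤-trans (≼-length r1≼p) (≼-length p≼r))))

    extend : ∀ {p x} → OnPath p x → Σ Word λ x′ → OnPath p x′ × length x < length x′
    extend {p} {x} (p≼x , gx , left) with good (x ++ [ false ]) in g₀
    ... | true = x ++ [ false ] , (≼-trans p≼x (≼-++ x _) , g₀ , left₀) , longer false
      where
      left₀ : Leftmost p (x ++ [ false ])
      left₀ r p≼r r1≼x0 with ≼-snoc x false r1≼x0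
      ... | inj₁ r1≼x = left r p≼r r1≼x
      ... | inj₂ e with ∷ʳ-injectiveʳ r x e
      ...   | ()
      longer : ∀ b → length x < length (x ++ [ b ])
      longer b = ≤-reflexive (sym (length-snoc x b))
    ... | false with good (x ++ [ true ]) in g₁
    ...   | true = x ++ [ true ] , (≼-trans p≼x (≼-++ x _) , g₁ , left₁) , ≤-reflexive (sym (length-snoc x true))
      where
      left₁ : Leftmost p (x ++ [ true ])
      left₁ r p≼r r1≼x1 with ≼-snoc x true r1≼x1
      ... | inj₁ r1≼x = left r p≼r r1≼x
      ... | inj₂ e rewrite ∷ʳ-injectiveˡ r x e = g₀
    ...   | false = ⊥-elim (fertile-child x (good⇒fertile gx)
                      (λ f → not-both (fertile⇒good f) g₀) (λ f → not-both (fertile⇒good f) g₁))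

    grow : ∀ {p} → good p ≡ true → ∀ t → Σ Word λ x → OnPath p x × t ≤ length x
    grow gp zero = _ , start gp , z≤n
    grow gp (suc t) with grow gp t
    ... | x , on , t≤x with extend on
    ...   | x′ , on′ , x<x′ = x′ , on′ , ≤-trans (s≤s t≤x) x<x′

    no-crossing : ∀ {p r x y} → OnPath p x → OnPath p y → Splits r x y → ⊥
    no-crossing {r = r} (p≼x , gx , _) (p≼y , _ , left) sp@(r0≼x , r1≼y) =
      not-both (good-prefix r0≼x gx) (left r (splits-below p≼x p≼y sp) r1≼y)

    leftmost-branch : ∀ {p} → good p ≡ true → IsBranch S (leftmost p)
    leftmost-branch {p} gp = member , closed , infinite , linear
      where
      member : ∀ x → leftmost p x → S x
      member x (inj₁ x≼p)         = tree x p x≼p (proj₁ (good⇒fertile gp))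
      member x (inj₂ (_ , gx , _)) = proj₁ (good⇒fertile gx)

      closed : IsTree (leftmost p)
      closed q x q≼x (inj₁ x≼p) = inj₁ (≼-trans q≼x x≼p)
      closed q x q≼x (inj₂ (p≼x , gx , left)) with ≼-comparable q≼x p≼x
      ... | inj₁ q≼p = inj₁ q≼p
      ... | inj₂ p≼q = inj₂ (p≼q , good-prefix q≼x gx , λ r p≼r r1≼q → left r p≼r (≼-trans r1≼q q≼x))

      infinite : Infinite (leftmost p)
      infinite = unbounded⇒infinite (leftmost p) λ t →
        let (x , on , t≤x) = grow gp t in x , inj₂ on , t≤x

      linear : ∀ x y → leftmost p x → leftmost p y → x ≼ y ⊎ y ≼ x
      linear x y (inj₁ x≼p) (inj₁ y≼p)        = ≼-comparable x≼p y≼p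
      linear x y (inj₁ x≼p) (inj₂ (p≼y , _))  = inj₁ (≼-trans x≼p p≼y)
      linear x y (inj₂ (p≼x , _)) (inj₁ y≼p)  = inj₂ (≼-trans y≼p p≼x)
      linear x y (inj₂ onx) (inj₂ ony) with compare x y
      ... | inj₁ x≼y                = inj₁ x≼y
      ... | inj₂ (inj₁ y≼x)         = inj₂ y≼x
      ... | inj₂ (inj₂ (r , inj₁ sp)) = ⊥-elim (no-crossing onx ony sp)
      ... | inj₂ (inj₂ (r , inj₂ sp)) = ⊥-elim (no-crossing ony onx sp)

    fertile-fork : ∀ r → Fertile (r ++ [ false ]) → Fertile (r ++ [ true ]) → d S r
    fertile-fork r f₀ f₁ =
      tree r (r ++ [ false ]) (≼-++ r _) (proj₁ f₀) ,
      leftmost (r ++ [ false ]) , leftmost (r ++ [ true ]) ,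
      leftmost-branch (fertile⇒good f₀) , leftmost-branch (fertile⇒good f₁) ,
      distinct , inj₁ (≼-++ r _) , inj₁ (≼-++ r _)
      where
      distinct : ¬ SameSet (leftmost (r ++ [ false ])) (leftmost (r ++ [ true ]))
      distinct same with Equivalence.to (same (r ++ [ false ])) (inj₁ (≼-refl _))
      ... | inj₁ r0≼r1       = children-apart r r0≼r1 (≼-refl _)
      ... | inj₂ (r1≼r0 , _) = children-apart r (≼-refl _) r1≼r0

module RegularTree (T : Pred 0ℓ) (tree : IsTree T) {k : ℕ} (δ : Fin k → Bool → Fin k) (q₀ : Fin k)
                   (compatible : Automaton.Compatible δ q₀ T) where
  open Automaton δ q₀

  module Rank (m : ℕ) = Fertility (dIter m T) (dIter-tree T tree m)
  open Rank using (Fertile)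

  rank⇒¬¬fertile : ∀ m {u} → IsCB (T ↾ u) (suc m) → ¬ ¬ Fertile m u
  rank⇒¬¬fertile m {u} (_ , infinite) ¬fertile =
    Rank.infinite-above⇒¬¬member m u above (λ s → ¬fertile (s , above))
    where
    above : Infinite (λ w → dIter m T (u ++ w))
    above finite = infinite m (n<1+n m)
      (finite-⊆ finite (dIter-shift {T ↾ u} {T} [] u tree (λ w t → t) m))

  -- Two fertile words of d^(m)(T) agreeing on k letters cannot split apart,
  -- since the split point would be a long word of the finite set d^(m+1)(T).
  no-long-fork : ∀ m → Finite (dIter (suc m) T) → ∀ {r u v} → Splits r u v →
    Fertile m u → Fertile m v → take k u ≡ take k v → ⊥
  no-long-fork m finite {r} sp@(r0≼u , r1≼v) fu fv e =
    ¬¬-state-classifier (Fertile m) fertile-compatible λ (γ , classifies) →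
      <⇒≱ (pumping (dIter-compatible tree compatible (suc m)) finite
             (Rank.Classified.fertile-fork m (γ ∘ state) classifies r
               (Rank.fertile-prefix m r0≼u fu) (Rank.fertile-prefix m r1≼v fv)))
          (splits-late k sp e)
    where
    fertile-compatible : ∀ x x′ → state x ≡ state x′ → Fertile m x → Fertile m x′
    fertile-compatible x x′ same = Rank.fertile-transfer m (dIter-compatible tree compatible m x x′ same)

  separated : ∀ n → IsCB T n → ∀ {A} → A ⊆ T → AntiChain A → ∀ {u v} → A u → A v →
    IsCB (T ↾ u) n → IsCB (T ↾ v) n → take k u ≡ take k v → u ≡ v
  separated zero (finite , _) {A} A⊆T _ {u} {v} au av _ _ e = trans (sym (short u au)) (trans e (short v av))
    where
    short : ∀ w → A w → take k w ≡ w
    short w aw = take-all k w (<⇒≤ (pumping (dIter-compatible tree compatible 0) finite (lift (A⊆T w aw))))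
  separated (suc m) (finite , _) _ anti {u} {v} au av cbu cbv e =
    decidable-stable (≡-dec Bool._≟_ u v) λ u≢v →
      rank⇒¬¬fertile m cbu λ fu → rank⇒¬¬fertile m cbv λ fv →
      fork (antichain-splits anti au av u≢v) fu fv
    where
    fork : (Σ Word λ r → Splits r u v ⊎ Splits r v u) → Fertile m u → Fertile m v → ⊥
    fork (r , inj₁ sp) fu fv = no-long-fork m finite sp fu fv e
    fork (r , inj₂ sp) fu fv = no-long-fork m finite sp fv fu (sym e)

-- The theorem, with C the number of words of length ≤ k for a k-state automaton.
-- (T_bin-freeness only guarantees that CB_*(T) exists; IsCB is assumed here.)
lemma42 : (T : Pred 0ℓ) → IsTree T → Regular T → TbinFree T →
    Σ ℕ λ C → (n : ℕ) → IsCB T n →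
    (A : Pred 0ℓ) → A ⊆ T → AntiChain A →
    (L : List Word) → Unique L →
    All (λ u → A u × IsCB (T ↾ u) n) L →
    length L ≤ C
lemma42 T tree (k , δ , q₀ , F , accepts) _ = length (words≤ k) , bound
  where
  open Automaton δ q₀ using (accepted-compatible)
  open RegularTree T tree δ q₀ (accepted-compatible F T accepts)

  bound : (n : ℕ) → IsCB T n → (A : Pred 0ℓ) → A ⊆ T → AntiChain A →
    (L : List Word) → Unique L → All (λ u → A u × IsCB (T ↾ u) n) L → length L ≤ length (words≤ k)
  bound n cb A A⊆T anti L unique members =
    length-≤-injection (take k) unique truncation-injective (λ {u} _ → take-∈-words≤ k u)
    where
    truncation-injective : ∀ {u v} → u ∈ L → v ∈ L → take k u ≡ take k v → u ≡ v
    truncation-injective u∈L v∈L with All.lookup members u∈L | All.lookup members v∈L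
    ... | au , cbu | av , cbv = separated n cb A⊆T anti au av cbu cbv
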